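{- Let $S\subset\mathbb{F}_2^n$ and let $\varphi:\mathbb{F}_2^n\to\mathbb{F}_2^n$ be a linear isomorphism. Then $b(\varphi(S))=b(S)$.
   Context: For $\mathbf{x},\mathbf{y}\in\mathbb{F}_2^n$ the pairing is $\mathbf{x}\cdot\mathbf{y}=\sum_{i=1}^n x_iy_i\in\mathbb{F}_2$, and $H_{\mathbf{y}}=\{\mathbf{x}\in\mathbb{F}_2^n\mid \mathbf{x}\cdot\mathbf{y}=0\}$. For a nonzero $\mathbf{y}$, a set $S$ is $\mathbf{y}$-balanced if $\#(S\cap H_{\mathbf{y}})=\#S/2$. $S$ is $\mathbf{y}$-constant if $S\subset H_{\mathbf{y}}$ or $S\cap H_{\mathbf{y}}=\emptyset$. The balancing set $B(S)$ is the set of nonzero $\mathbf{y}$ such that $S$ is $\mathbf{y}$-balanced; the constant set $C(S)$ is the set of $\mathbf{y}$ such that $S$ is $\mathbf{y}$-constant. The balancing number is $b(S)=\#B(S)/\#C(S)$. -}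

module Defs where

open import Data.Bool using (Bool; true; false; _∧_; _∨_; not; _xor_)
open import Data.Nat using (ℕ; zero; suc; _*_; _≡ᵇ_; NonZero; _>_; s≤s; z≤n; >-nonZero)
open import Data.List using (List; []; _∷_; _++_; map; filter; length)
open import Data.Bool.ListAction using (any)
open import Data.Vec using (Vec; []; _∷_; zipWith; replicate)
import Data.Vec
open import Data.Vec.Properties using (≡-dec)
import Data.Bool.Properties as BP
open import Data.Integer using (+_)
open import Data.Rational using (ℚ; _/_)
open import Relation.Nullary using (does)
open import Relation.Binary.PropositionalEquality using (_≡_; refl)
open import Function.Definitions using (Bijective)
open import Data.Product using (_×_)

-- Vectors of 𝔽₂ⁿ are Vec Bool n (false = 0, true = 1), addition = xor.
𝔽₂ⁿ : ℕ → Set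
𝔽₂ⁿ n = Vec Bool n

allVecs : (n : ℕ) → List (𝔽₂ⁿ n)
allVecs zero = [] ∷ []
allVecs (suc n) = map (false ∷_) (allVecs n) ++ map (true ∷_) (allVecs n)

Subset₂ : ℕ → Set
Subset₂ n = 𝔽₂ⁿ n → Bool

card : {n : ℕ} → Subset₂ n → ℕ
card {n} S = length (filter (λ x → S x BP.≟ true) (allVecs n))

dot : {n : ℕ} → 𝔽₂ⁿ n → 𝔽₂ⁿ n → Bool
dot [] [] = false
dot (x ∷ xs) (y ∷ ys) = (x ∧ y) xor dot xs ys

H : {n : ℕ} → 𝔽₂ⁿ n → Subset₂ n
H y x = not (dot x y)

_∩_ : {n : ℕ} → Subset₂ n → Subset₂ n → Subset₂ n
(S ∩ T) x = S x ∧ T x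

isZero : {n : ℕ} → 𝔽₂ⁿ n → Bool
isZero y = does (≡-dec BP._≟_ y (replicate _ false))

-- S is y-balanced : #(S ∩ H_y) = #S / 2  (i.e. 2·#(S ∩ H_y) = #S)
balanced : {n : ℕ} → Subset₂ n → 𝔽₂ⁿ n → Bool
balanced S y = (2 * card (S ∩ H y)) ≡ᵇ card S

-- S is y-constant : S ⊂ H_y  or  S ∩ H_y = ∅
constant : {n : ℕ} → Subset₂ n → 𝔽₂ⁿ n → Bool
constant S y = (card (S ∩ H y) ≡ᵇ card S) ∨ (card (S ∩ H y) ≡ᵇ 0)

B : {n : ℕ} → Subset₂ n → Subset₂ n
B S y = not (isZero y) ∧ balanced S y

C : {n : ℕ} → Subset₂ n → Subset₂ n
C S y = constant S y

-- #C(S) ≥ 1 since 0 ∈ C(S); this gives the NonZero instance for b(S)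
private
  open import Data.List.Membership.Propositional using (_∈_)
  open import Data.List.Membership.Propositional.Properties using (∈-map⁺; ∈-++⁺ˡ; ∈-filter⁺; ∈-length)
  open import Data.List.Relation.Unary.Any using (here)
  open import Relation.Binary.PropositionalEquality using (cong; trans)
  open import Data.Nat.Properties using (≡⇒≡ᵇ)

  zero∈ : (n : ℕ) → replicate n false ∈ allVecs n
  zero∈ zero = here refl
  zero∈ (suc n) = ∈-++⁺ˡ (∈-map⁺ (false ∷_) (zero∈ n))

  dot0 : {n : ℕ} (x : 𝔽₂ⁿ n) → dot x (replicate n false) ≡ false
  dot0 [] = refl
  dot0 (false ∷ x) = dot0 x
  dot0 (true ∷ x) = dot0 x

  cnt : {A : Set} → (A → Bool) → List A → ℕ
  cnt p xs = length (filter (λ x → p x BP.≟ true) xs)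

  cnt-cong : {A : Set} (p q : A → Bool) → (∀ x → p x ≡ q x) → (xs : List A) → cnt p xs ≡ cnt q xs
  cnt-cong p q e [] = refl
  cnt-cong p q e (x ∷ xs) with p x | q x | e x
  ... | true | .true | refl = cong suc (cnt-cong p q e xs)
  ... | false | .false | refl = cnt-cong p q e xs

  ∧-not-false : (b c : Bool) → c ≡ false → (b ∧ not c) ≡ b
  ∧-not-false false c _ = refl
  ∧-not-false true .false refl = refl

  refl-ᵇ : (m : ℕ) (c : Bool) → ((m ≡ᵇ m) ∨ c) ≡ true
  refl-ᵇ zero c = refl
  refl-ᵇ (suc m) c = refl-ᵇ m c

  C0 : {n : ℕ} (S : Subset₂ n) → C S (replicate n false) ≡ true
  C0 {n} S rewrite cnt-cong _ S (λ x → ∧-not-false (S x) _ (dot0 x)) (allVecs n) = refl-ᵇ (card S) _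

#C-pos : {n : ℕ} (S : Subset₂ n) → card (C S) > 0
#C-pos {n} S = ∈-length (∈-filter⁺ (λ x → C S x BP.≟ true) (zero∈ n) (C0 S))

#C-nonZero : {n : ℕ} (S : Subset₂ n) → NonZero (card (C S))
#C-nonZero S = >-nonZero (#C-pos S)

b : {n : ℕ} → Subset₂ n → ℚ
b S = _/_ (+ card (B S)) (card (C S)) {{#C-nonZero S}}

_⊕_ : {n : ℕ} → 𝔽₂ⁿ n → 𝔽₂ⁿ n → 𝔽₂ⁿ n
_⊕_ = zipWith _xor_

_·_ : {n : ℕ} → Bool → 𝔽₂ⁿ n → 𝔽₂ⁿ n
c · x = Data.Vec.map (c ∧_) x

record IsLinearIso {n : ℕ} (φ : 𝔽₂ⁿ n → 𝔽₂ⁿ n) : Set where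
  field
    additive    : ∀ x y → φ (x ⊕ y) ≡ φ x ⊕ φ y
    homogeneous : ∀ (c : Bool) x → φ (c · x) ≡ c · φ x
    bijective   : Bijective _≡_ _≡_ φ

image : {n : ℕ} → (𝔽₂ⁿ n → 𝔽₂ⁿ n) → Subset₂ n → Subset₂ n
image {n} φ S y = any (λ x → S x ∧ does (≡-dec BP._≟_ (φ x) y)) (allVecs n)

module Submission where

open import Defs
open import Data.Nat using (ℕ)
open import Relation.Binary.PropositionalEquality using (_≡_)

open import Algebra.Bundles using (CommutativeRing)
open import Data.Bool using (Bool; true; false; T; _∧_; _∨_; not; _xor_)
import Data.Bool.Properties as BP
open import Data.Empty using (⊥-elim)
open import Data.Integer using (+_)
open import Data.List using ([]; _∷_; map; filter; length)
open import Data.List.Membership.Propositional using (_∈_; lose)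
open import Data.List.Membership.Propositional.Properties using (∈-map⁺; ∈-map⁻; ∈-++⁺ˡ; ∈-++⁺ʳ)
open import Data.List.Membership.Propositional.Properties.WithK using (unique∧set⇒bag)
open import Data.List.Properties using (filter-≐)
open import Data.List.Relation.Binary.BagAndSetEquality using (∼bag⇒↭)
open import Data.List.Relation.Binary.Permutation.Propositional using (_↭_)
open import Data.List.Relation.Binary.Permutation.Propositional.Properties using (↭-length; filter-↭)
import Data.List.Relation.Unary.All as All
import Data.List.Relation.Unary.AllPairs as AllPairs
open import Data.List.Relation.Unary.Any using (here; satisfied)
open import Data.List.Relation.Unary.Any.Properties using (any⁺; any⁻)
open import Data.List.Relation.Unary.Unique.Propositional using (Unique)
import Data.List.Relation.Unary.Unique.Propositional.Properties as Unique
open import Data.Nat using (zero; suc; _*_; _≡ᵇ_; NonZero)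
open import Data.Product using (_×_; _,_; proj₁; proj₂)
open import Data.Rational using (_/_)
open import Data.Vec using (Vec; []; _∷_; replicate)
import Data.Vec as Vec
open import Data.Vec.Properties using (∷-injectiveʳ; map-∘; ≡-dec)
open import Function using (_∘_; _↔_; Inverse; Injection; Equivalence; mk⇔; mk⤖; mk↔ₛ′)
open import Function.Properties.Bijection using (⤖⇒↔)
open import Function.Properties.Inverse using (↔⇒↣)
open import Relation.Binary.PropositionalEquality using (refl; sym; trans; cong; cong₂; subst; module ≡-Reasoning)
open import Relation.Nullary using (¬_; does; yes; no)
open import Relation.Nullary.Decidable using (dec-true; does-⇔)

open import Algebra.Properties.CommutativeSemigroup
  (CommutativeRing.+-commutativeSemigroup BP.xor-∧-commutativeRing) using (interchange)

-- Precomposing S with a linear bijection φ permutes the vectors, so #φ(S) = #S; and by the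
-- adjoint identity φ(x)·y = x·φᵀ(y) the hyperplane H_y pulls back to H_{φᵀ y}, so
-- #(φ(S) ∩ H_y) = #(S ∩ H_{φᵀ y}).  Hence B(φ(S)) and C(φ(S)) are the preimages of B(S) and
-- C(S) under the bijection φᵀ, and have the same sizes.

allVecs-complete : {n : ℕ} (x : 𝔽₂ⁿ n) → x ∈ allVecs n
allVecs-complete [] = here refl
allVecs-complete {suc n} (false ∷ x) = ∈-++⁺ˡ (∈-map⁺ (false ∷_) (allVecs-complete x))
allVecs-complete {suc n} (true ∷ x) =
  ∈-++⁺ʳ (map (false ∷_) (allVecs n)) (∈-map⁺ (true ∷_) (allVecs-complete x))

allVecs-unique : (n : ℕ) → Unique (allVecs n)
allVecs-unique zero = All.[] AllPairs.∷ AllPairs.[]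
allVecs-unique (suc n) = Unique.++⁺ (cons-unique false) (cons-unique true) disjoint
  where
  cons-unique : (a : Bool) → Unique (map (a ∷_) (allVecs n))
  cons-unique a = Unique.map⁺ ∷-injectiveʳ (allVecs-unique n)
  disjoint : ∀ {v} → ¬ (v ∈ map (false ∷_) (allVecs n) × v ∈ map (true ∷_) (allVecs n))
  disjoint (p , q) with ∈-map⁻ (false ∷_) p | ∈-map⁻ (true ∷_) q
  ... | _ , _ , refl | _ , _ , ()

card-cong : {n : ℕ} {P Q : Subset₂ n} → (∀ x → P x ≡ Q x) → card P ≡ card Q
card-cong {n} e = cong length (filter-≐ _ _ ((λ {x} → trans (sym (e x))) , (λ {x} → trans (e x))) (allVecs n))

module _ {n : ℕ} (f : 𝔽₂ⁿ n ↔ 𝔽₂ⁿ n) where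
  open Inverse f

  map-allVecs-↭ : map to (allVecs n) ↭ allVecs n
  map-allVecs-↭ = ∼bag⇒↭ (unique∧set⇒bag (Unique.map⁺ (Injection.injective (↔⇒↣ f)) (allVecs-unique n))
                                         (allVecs-unique n)
                                         (λ {y} → mk⇔ (λ _ → allVecs-complete y) (λ _ → ∈-image y)))
    where
    ∈-image : ∀ y → y ∈ map to (allVecs n)
    ∈-image y = subst (_∈ map to (allVecs n)) (strictlyInverseˡ y) (∈-map⁺ to (allVecs-complete (from y)))

  card-∘-inverse : (P : Subset₂ n) → card (P ∘ to) ≡ card P
  card-∘-inverse P = trans (length-filter-map (allVecs n)) (↭-length (filter-↭ _ map-allVecs-↭))
    where
    length-filter-map : ∀ xs → length (filter (λ x → P (to x) BP.≟ true) xs)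
                             ≡ length (filter (λ y → P y BP.≟ true) (map to xs))
    length-filter-map [] = refl
    length-filter-map (x ∷ xs) with P (to x)
    ... | true  = cong suc (length-filter-map xs)
    ... | false = length-filter-map xs

0ᵥ : {n : ℕ} → 𝔽₂ⁿ n
0ᵥ {n} = replicate n false

record IsLinear {m n : ℕ} (f : 𝔽₂ⁿ m → 𝔽₂ⁿ n) : Set where
  field
    additive    : ∀ x y → f (x ⊕ y) ≡ f x ⊕ f y
    homogeneous : ∀ (c : Bool) x → f (c · x) ≡ c · f x

false·x≡0 : {n : ℕ} (x : 𝔽₂ⁿ n) → false · x ≡ 0ᵥ
false·x≡0 [] = refl
false·x≡0 (a ∷ x) = cong (false ∷_) (false·x≡0 x)

c·0≡0 : {n : ℕ} (c : Bool) → c · 0ᵥ {n} ≡ 0ᵥ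
c·0≡0 {zero} c = refl
c·0≡0 {suc n} c = cong₂ _∷_ (BP.∧-zeroʳ c) (c·0≡0 c)

⊕-identityˡ : {n : ℕ} (x : 𝔽₂ⁿ n) → 0ᵥ ⊕ x ≡ x
⊕-identityˡ [] = refl
⊕-identityˡ (a ∷ x) = cong (a ∷_) (⊕-identityˡ x)

linear-0 : {m n : ℕ} {f : 𝔽₂ⁿ m → 𝔽₂ⁿ n} → IsLinear f → f 0ᵥ ≡ 0ᵥ
linear-0 {f = f} lin = begin
  f 0ᵥ             ≡⟨ cong f (false·x≡0 0ᵥ) ⟨
  f (false · 0ᵥ)   ≡⟨ IsLinear.homogeneous lin false 0ᵥ ⟩
  false · f 0ᵥ     ≡⟨ false·x≡0 (f 0ᵥ) ⟩
  0ᵥ               ∎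
  where open ≡-Reasoning

dot-0ˡ : {n : ℕ} (y : 𝔽₂ⁿ n) → dot 0ᵥ y ≡ false
dot-0ˡ [] = refl
dot-0ˡ (a ∷ y) = dot-0ˡ y

dot-0ʳ : {n : ℕ} (x : 𝔽₂ⁿ n) → dot x 0ᵥ ≡ false
dot-0ʳ [] = refl
dot-0ʳ (a ∷ x) = trans (cong (_xor dot x 0ᵥ) (BP.∧-zeroʳ a)) (dot-0ʳ x)

dot-⊕ˡ : {n : ℕ} (x x′ y : 𝔽₂ⁿ n) → dot (x ⊕ x′) y ≡ dot x y xor dot x′ y
dot-⊕ˡ [] [] [] = refl
dot-⊕ˡ (a ∷ x) (a′ ∷ x′) (c ∷ y) = begin
  ((a xor a′) ∧ c) xor dot (x ⊕ x′) y               ≡⟨ cong₂ _xor_ (BP.∧-distribʳ-xor c a a′) (dot-⊕ˡ x x′ y) ⟩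
  ((a ∧ c) xor (a′ ∧ c)) xor (dot x y xor dot x′ y) ≡⟨ interchange (a ∧ c) (a′ ∧ c) (dot x y) (dot x′ y) ⟩
  ((a ∧ c) xor dot x y) xor ((a′ ∧ c) xor dot x′ y) ∎
  where open ≡-Reasoning

dot-·ˡ : {n : ℕ} (c : Bool) (x y : 𝔽₂ⁿ n) → dot (c · x) y ≡ c ∧ dot x y
dot-·ˡ c [] [] = sym (BP.∧-zeroʳ c)
dot-·ˡ c (a ∷ x) (d ∷ y) = begin
  ((c ∧ a) ∧ d) xor dot (c · x) y   ≡⟨ cong₂ _xor_ (BP.∧-assoc c a d) (dot-·ˡ c x y) ⟩
  (c ∧ (a ∧ d)) xor (c ∧ dot x y)   ≡⟨ BP.∧-distribˡ-xor c (a ∧ d) (dot x y) ⟨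
  c ∧ ((a ∧ d) xor dot x y)         ∎
  where open ≡-Reasoning

lincomb : {k n : ℕ} → Vec Bool k → Vec (𝔽₂ⁿ n) k → 𝔽₂ⁿ n
lincomb [] [] = 0ᵥ
lincomb (c ∷ cs) (v ∷ vs) = (c · v) ⊕ lincomb cs vs

linear-lincomb : {k m n : ℕ} {f : 𝔽₂ⁿ m → 𝔽₂ⁿ n} → IsLinear f →
                 (cs : Vec Bool k) (vs : Vec (𝔽₂ⁿ m) k) → f (lincomb cs vs) ≡ lincomb cs (Vec.map f vs)
linear-lincomb lin [] [] = linear-0 lin
linear-lincomb {f = f} lin (c ∷ cs) (v ∷ vs) = begin
  f ((c · v) ⊕ lincomb cs vs)           ≡⟨ additive (c · v) (lincomb cs vs) ⟩
  f (c · v) ⊕ f (lincomb cs vs)         ≡⟨ cong₂ _⊕_ (homogeneous c v) (linear-lincomb lin cs vs) ⟩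
  (c · f v) ⊕ lincomb cs (Vec.map f vs) ∎
  where
  open ≡-Reasoning
  open IsLinear lin

dot-lincombˡ : {k n : ℕ} (cs : Vec Bool k) (vs : Vec (𝔽₂ⁿ n) k) (y : 𝔽₂ⁿ n) →
               dot (lincomb cs vs) y ≡ dot cs (Vec.map (λ v → dot v y) vs)
dot-lincombˡ [] [] y = dot-0ˡ y
dot-lincombˡ (c ∷ cs) (v ∷ vs) y = begin
  dot ((c · v) ⊕ lincomb cs vs) y                       ≡⟨ dot-⊕ˡ (c · v) (lincomb cs vs) y ⟩
  dot (c · v) y xor dot (lincomb cs vs) y               ≡⟨ cong₂ _xor_ (dot-·ˡ c v y) (dot-lincombˡ cs vs y) ⟩
  (c ∧ dot v y) xor dot cs (Vec.map (λ v → dot v y) vs) ∎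
  where open ≡-Reasoning

standardBasis : (n : ℕ) → Vec (𝔽₂ⁿ n) n
standardBasis zero = []
standardBasis (suc n) = (true ∷ 0ᵥ) ∷ Vec.map (false ∷_) (standardBasis n)

lincomb-map-false∷ : {k n : ℕ} (cs : Vec Bool k) (vs : Vec (𝔽₂ⁿ n) k) →
                     lincomb cs (Vec.map (false ∷_) vs) ≡ false ∷ lincomb cs vs
lincomb-map-false∷ [] [] = refl
lincomb-map-false∷ (c ∷ cs) (v ∷ vs) =
  cong₂ _⊕_ (cong (_∷ (c · v)) (BP.∧-zeroʳ c)) (lincomb-map-false∷ cs vs)

lincomb-standardBasis : {n : ℕ} (x : 𝔽₂ⁿ n) → lincomb x (standardBasis n) ≡ x
lincomb-standardBasis [] = refl
lincomb-standardBasis {suc n} (a ∷ x) = begin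
  (a · (true ∷ 0ᵥ)) ⊕ lincomb x (Vec.map (false ∷_) (standardBasis n))
    ≡⟨ cong ((a · (true ∷ 0ᵥ)) ⊕_) (lincomb-map-false∷ x (standardBasis n)) ⟩
  ((a ∧ true) xor false) ∷ ((a · 0ᵥ) ⊕ lincomb x (standardBasis n))
    ≡⟨ cong₂ _∷_ (trans (BP.xor-identityʳ _) (BP.∧-identityʳ a))
                 (cong₂ _⊕_ (c·0≡0 a) (lincomb-standardBasis x)) ⟩
  a ∷ (0ᵥ ⊕ x)
    ≡⟨ cong (a ∷_) (⊕-identityˡ x) ⟩
  a ∷ x ∎
  where open ≡-Reasoning

transpose : {m n : ℕ} → (𝔽₂ⁿ m → 𝔽₂ⁿ n) → 𝔽₂ⁿ n → 𝔽₂ⁿ m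
transpose {m} f y = Vec.map (λ e → dot (f e) y) (standardBasis m)

dot-transpose : {m n : ℕ} {f : 𝔽₂ⁿ m → 𝔽₂ⁿ n} → IsLinear f →
                (x : 𝔽₂ⁿ m) (y : 𝔽₂ⁿ n) → dot (f x) y ≡ dot x (transpose f y)
dot-transpose {m} {f = f} lin x y = begin
  dot (f x) y
    ≡⟨ cong (λ z → dot (f z) y) (lincomb-standardBasis x) ⟨
  dot (f (lincomb x (standardBasis m))) y
    ≡⟨ cong (λ z → dot z y) (linear-lincomb lin x (standardBasis m)) ⟩
  dot (lincomb x (Vec.map f (standardBasis m))) y
    ≡⟨ dot-lincombˡ x (Vec.map f (standardBasis m)) y ⟩
  dot x (Vec.map (λ v → dot v y) (Vec.map f (standardBasis m)))
    ≡⟨ cong (dot x) (map-∘ (λ v → dot v y) f (standardBasis m)) ⟨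
  dot x (transpose f y) ∎
  where open ≡-Reasoning

dot-injectiveʳ : {n : ℕ} {y y′ : 𝔽₂ⁿ n} → (∀ x → dot x y ≡ dot x y′) → y ≡ y′
dot-injectiveʳ {zero} {[]} {[]} _ = refl
dot-injectiveʳ {suc n} {a ∷ y} {a′ ∷ y′} e = cong₂ _∷_ heads-equal (dot-injectiveʳ (λ x → e (false ∷ x)))
  where
  dot-e₀ : ∀ {c} (z : 𝔽₂ⁿ n) → dot (true ∷ 0ᵥ) (c ∷ z) ≡ c
  dot-e₀ {c} z = trans (cong (c xor_) (dot-0ˡ z)) (BP.xor-identityʳ c)
  heads-equal : a ≡ a′
  heads-equal = trans (sym (dot-e₀ y)) (trans (e (true ∷ 0ᵥ)) (dot-e₀ y′))

transpose-0 : {m n : ℕ} {f : 𝔽₂ⁿ m → 𝔽₂ⁿ n} → IsLinear f → transpose f 0ᵥ ≡ 0ᵥ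
transpose-0 {f = f} lin = dot-injectiveʳ λ x →
  trans (sym (dot-transpose lin x 0ᵥ)) (trans (dot-0ʳ (f x)) (sym (dot-0ʳ x)))

transpose-inverse : {m n : ℕ} {f : 𝔽₂ⁿ m → 𝔽₂ⁿ n} {g : 𝔽₂ⁿ n → 𝔽₂ⁿ m} → IsLinear f → IsLinear g →
                    (∀ x → f (g x) ≡ x) → ∀ y → transpose g (transpose f y) ≡ y
transpose-inverse {f = f} {g} linf ling fg y = dot-injectiveʳ λ x → begin
  dot x (transpose g (transpose f y)) ≡⟨ dot-transpose ling x (transpose f y) ⟨
  dot (g x) (transpose f y)           ≡⟨ dot-transpose linf (g x) y ⟨
  dot (f (g x)) y                     ≡⟨ cong (λ z → dot z y) (fg x) ⟩
  dot x y                             ∎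
  where open ≡-Reasoning

module _ {n : ℕ} (f : 𝔽₂ⁿ n ↔ 𝔽₂ⁿ n) where
  open Inverse f

  to-injective : ∀ {x y} → to x ≡ to y → x ≡ y
  to-injective = Injection.injective (↔⇒↣ f)

  from-linear : IsLinear to → IsLinear from
  from-linear lin = record
    { additive    = λ x y → to-injective (begin
        to (from (x ⊕ y))           ≡⟨ strictlyInverseˡ (x ⊕ y) ⟩
        x ⊕ y                       ≡⟨ cong₂ _⊕_ (strictlyInverseˡ x) (strictlyInverseˡ y) ⟨
        to (from x) ⊕ to (from y)   ≡⟨ additive (from x) (from y) ⟨
        to (from x ⊕ from y)        ∎)
    ; homogeneous = λ c x → to-injective (begin
        to (from (c · x))           ≡⟨ strictlyInverseˡ (c · x) ⟩
        c · x                       ≡⟨ cong (c ·_) (strictlyInverseˡ x) ⟨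
        c · to (from x)             ≡⟨ homogeneous c (from x) ⟨
        to (c · from x)             ∎)
    }
    where
    open ≡-Reasoning
    open IsLinear lin

  transpose-↔ : IsLinear to → 𝔽₂ⁿ n ↔ 𝔽₂ⁿ n
  transpose-↔ lin = mk↔ₛ′ (transpose to) (transpose from)
    (transpose-inverse (from-linear lin) lin strictlyInverseʳ)
    (transpose-inverse lin (from-linear lin) strictlyInverseˡ)

  image-↔ : (S : Subset₂ n) (y : 𝔽₂ⁿ n) → image to S y ≡ S (from y)
  image-↔ S y = BP.⇔→≡ {z = true} (mk⇔ image⇒from image⇐from)
    where
    hits : 𝔽₂ⁿ n → Bool
    hits x = S x ∧ does (≡-dec BP._≟_ (to x) y)
    image⇐from : S (from y) ≡ true → image to S y ≡ true
    image⇐from e = Equivalence.to BP.T-≡ (any⁺ hits (lose (allVecs-complete (from y))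
      (Equivalence.from BP.T-∧ (Equivalence.from BP.T-≡ e
                              , Equivalence.from BP.T-≡ (dec-true (≡-dec BP._≟_ _ y) (strictlyInverseˡ y))))))
    hit⇒preimage : ∀ x → T (hits x) → to x ≡ y × T (S x)
    hit⇒preimage x with ≡-dec BP._≟_ (to x) y
    ... | yes tx≡y = λ hit → tx≡y , proj₁ (Equivalence.to BP.T-∧ hit)
    ... | no _     = λ hit → ⊥-elim (proj₂ (Equivalence.to BP.T-∧ hit))
    image⇒from : image to S y ≡ true → S (from y) ≡ true
    image⇒from e with satisfied (any⁻ hits (allVecs n) (Equivalence.from BP.T-≡ e))
    ... | x , hit with hit⇒preimage x hit
    ...   | refl , Sx = Equivalence.to BP.T-≡ (subst (T ∘ S) (sym (strictlyInverseʳ x)) Sx)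

  image-to : (S : Subset₂ n) (x : 𝔽₂ⁿ n) → image to S (to x) ≡ S x
  image-to S x = trans (image-↔ S (to x)) (cong S (strictlyInverseʳ x))

  isZero-to : to 0ᵥ ≡ 0ᵥ → (y : 𝔽₂ⁿ n) → isZero (to y) ≡ isZero y
  isZero-to to0 y = does-⇔ (mk⇔ (λ e → to-injective (trans e (sym to0))) (λ e → trans (cong to e) to0))
                           (≡-dec BP._≟_ (to y) 0ᵥ) (≡-dec BP._≟_ y 0ᵥ)

module _ {n : ℕ} (φ : 𝔽₂ⁿ n ↔ 𝔽₂ⁿ n) (linear : IsLinear (Inverse.to φ)) (S : Subset₂ n) where
  open Inverse φ

  card-image : card (image to S) ≡ card S
  card-image = trans (sym (card-∘-inverse φ (image to S))) (card-cong (image-to φ S))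

  card-image-∩-H : ∀ y → card (image to S ∩ H y) ≡ card (S ∩ H (transpose to y))
  card-image-∩-H y = trans (sym (card-∘-inverse φ (image to S ∩ H y)))
    (card-cong λ x → cong₂ _∧_ (image-to φ S x) (cong not (dot-transpose linear x y)))

  B-image : ∀ y → B (image to S) y ≡ B S (transpose to y)
  B-image y = cong₂ _∧_ (cong not (sym (isZero-to (transpose-↔ φ linear) (transpose-0 linear) y)))
                        (cong₂ _≡ᵇ_ (cong (2 *_) (card-image-∩-H y)) card-image)

  C-image : ∀ y → C (image to S) y ≡ C S (transpose to y)
  C-image y = cong₂ _∨_ (cong₂ _≡ᵇ_ (card-image-∩-H y) card-image) (cong (_≡ᵇ 0) (card-image-∩-H y))

  #B-image : card (B (image to S)) ≡ card (B S)
  #B-image = trans (card-cong B-image) (card-∘-inverse (transpose-↔ φ linear) (B S))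

  #C-image : card (C (image to S)) ≡ card (C S)
  #C-image = trans (card-cong C-image) (card-∘-inverse (transpose-↔ φ linear) (C S))

-- The NonZero instance of _/_ is irrelevant, so equal numerators and denominators suffice.
/-cong : ∀ {p q m n : ℕ} .{{_ : NonZero m}} .{{_ : NonZero n}} → p ≡ q → m ≡ n → + p / m ≡ + q / n
/-cong refl refl = refl

proposition3 : (n : ℕ) (S : Subset₂ n) (φ : 𝔽₂ⁿ n → 𝔽₂ⁿ n) →
               IsLinearIso φ → b (image φ S) ≡ b S
proposition3 n S φ iso =
  /-cong {{#C-nonZero (image φ S)}} {{#C-nonZero S}} (#B-image φ↔ linear S) (#C-image φ↔ linear S)
  where
  open IsLinearIso iso
  φ↔ : 𝔽₂ⁿ n ↔ 𝔽₂ⁿ n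
  φ↔ = ⤖⇒↔ (mk⤖ bijective)
  linear : IsLinear φ
  linear = record { additive = additive ; homogeneous = homogeneous }
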